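{- Every graph that is palindromic or antipalindromic has an even number of vertices.
   Context: All graphs are finite, simple and undirected. For a graph $G$ on $n$ vertices with adjacency matrix $A_G$, its characteristic polynomial is $\chi_G(\lambda)=\det(\lambda I-A_G)=a_0\lambda^n+a_1\lambda^{n-1}+\dots+a_n$ (so $a_0=1$). $G$ is palindromic if $a_i=a_{n-i}$ for all $i=0,\dots,n$, and antipalindromic if $a_i=-a_{n-i}$ for all $i=0,\dots,n$. -}

module Defs where

open import Data.Bool using (Bool; true; false; if_then_else_)
open import Data.Nat as ℕ using (ℕ; zero; suc; _∸_)
open import Data.Fin using (Fin; zero; suc; punchIn; toℕ)
open import Data.Fin.Properties using (_≟_)
open import Data.Integer using (ℤ; +_; -_) renaming (_+_ to _+ℤ_; _*_ to _*ℤ_)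
open import Data.List using (List; []; _∷_)
open import Relation.Nullary using (does)
open import Relation.Binary.PropositionalEquality using (_≡_)

record Graph (n : ℕ) : Set where
  field
    adj   : Fin n → Fin n → Bool
    sym   : ∀ i j → adj i j ≡ adj j i
    irrefl : ∀ i → adj i i ≡ false

-- Integer polynomials as coefficient lists (constant term first).
-- Two lists representing the same polynomial may differ by trailing
-- zeros; we only ever inspect coefficients via `coeff`.

Poly : Set
Poly = List ℤ

_⊕_ : Poly → Poly → Poly
[] ⊕ q = q
(a ∷ p) ⊕ [] = a ∷ p
(a ∷ p) ⊕ (b ∷ q) = (a +ℤ b) ∷ (p ⊕ q)

scale : ℤ → Poly → Poly
scale c [] = []
scale c (a ∷ p) = (c *ℤ a) ∷ scale c p

_⊗_ : Poly → Poly → Poly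
[] ⊗ q = []
(a ∷ p) ⊗ q = scale a q ⊕ (+ 0 ∷ (p ⊗ q))

const : ℤ → Poly
const c = c ∷ []

X : Poly
X = + 0 ∷ + 1 ∷ []

coeff : Poly → ℕ → ℤ
coeff [] k = + 0
coeff (a ∷ p) zero = a
coeff (a ∷ p) (suc k) = coeff p k

sign : ℕ → ℤ
sign zero = + 1
sign (suc zero) = - (+ 1)
sign (suc (suc k)) = sign k

sumFin : ∀ {n} → (Fin n → Poly) → Poly
sumFin {zero} f = []
sumFin {suc n} f = f zero ⊕ sumFin (λ j → f (suc j))

det : ∀ {n} → (Fin n → Fin n → Poly) → Poly
det {zero} M = const (+ 1)
det {suc n} M =
  sumFin (λ j → scale (sign (toℕ j))
                  (M zero j ⊗ det (λ r c → M (suc r) (punchIn j c))))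

adjMatrix : ∀ {n} → Graph n → Fin n → Fin n → ℤ
adjMatrix G i j = if Graph.adj G i j then + 1 else + 0

charMatrix : ∀ {n} → Graph n → Fin n → Fin n → Poly
charMatrix G i j =
  (if does (i ≟ j) then X else []) ⊕ const (- adjMatrix G i j)

charPoly : ∀ {n} → Graph n → Poly
charPoly G = det (charMatrix G)

a : ∀ {n} → Graph n → ℕ → ℤ
a {n} G i = coeff (charPoly G) (n ∸ i)

Palindromic : ∀ {n} → Graph n → Set
Palindromic {n} G = ∀ (i : Fin (suc n)) → a G (toℕ i) ≡ a G (n ∸ toℕ i)

Antipalindromic : ∀ {n} → Graph n → Set
Antipalindromic {n} G = ∀ (i : Fin (suc n)) → a G (toℕ i) ≡ - a G (n ∸ toℕ i)

-- Odd order rules out both symmetries, because the two ends of χ_G have different parities: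
-- a₀ = 1, while aₙ = det(−A_G) is even.  Since A_G is symmetric with zero diagonal, A_G = U + Uᵀ
-- for the strictly upper triangular part U, so A_G ≡ U − Uᵀ (mod 2); a skew-symmetric integer
-- matrix S of odd order has det S = det Sᵀ = det(−S) = −det S, hence det S = 0.
module Submission where

open import Defs
open import Data.Nat using (ℕ)
open import Data.Nat.Divisibility using (_∣_)
open import Data.Sum using (_⊎_)

open import Algebra.Properties.CommutativeMonoid.Sum as Sum using ()
open import Algebra.Properties.Semiring.Sum as SemiringSum using ()
open import Data.Bool using (Bool; true; false; if_then_else_)
open import Data.Empty using (⊥-elim)
open import Data.Fin using (Fin; zero; suc; punchIn; toℕ)
open import Data.Fin.Properties using (_≟_; _<?_; <-cmp; <-irrefl)
open import Data.Integer
  using (ℤ; +_; -_; _+_; _-_; _*_; ∣_∣; -[1+_]; 0ℤ; 1ℤ; -1ℤ)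
open import Data.Integer.Properties
  using ( +-0-commutativeMonoid; +-*-semiring; +-identityˡ; +-identityʳ; *-identityˡ
        ; *-zeroʳ; abs-*; neg-involutive; neg-distrib-+; -1*i≡-i)
open import Data.Integer.Tactic.RingSolver using (solve-∀)
open import Data.List using ([]; _∷_)
open import Data.Nat as ℕ using (zero; suc; s≤s; z≤n)
open import Data.Nat.Divisibility using (divides)
open import Data.Nat.Properties using (n∸n≡0; n<1+n; m<n⇒m<1+n; even≢odd)
open import Data.Product using (Σ; _×_; _,_; proj₁)
open import Data.Sum using (inj₁; inj₂)
open import Relation.Binary.Definitions using (tri<; tri≈; tri>)
open import Relation.Binary.PropositionalEquality
open import Relation.Nullary using (does; ¬_)
open import Relation.Nullary.Decidable using (dec-true; dec-false)

open Sum +-0-commutativeMonoid using (sum; sum-cong-≗; sum-replicate-zero; ∑-comm)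
open SemiringSum +-*-semiring using (*-distribˡ-sum)

sum-zero : ∀ {n} {f : Fin n → ℤ} → (∀ i → f i ≡ 0ℤ) → sum f ≡ 0ℤ
sum-zero {n} f≗0 = trans (sum-cong-≗ f≗0) (sum-replicate-zero n)

sum-neg : ∀ {n} (f : Fin n → ℤ) → sum (λ i → - f i) ≡ - sum f
sum-neg {zero} f = refl
sum-neg {suc n} f =
  trans (cong (_+_ (- f zero)) (sum-neg (λ i → f (suc i)))) (sym (neg-distrib-+ (f zero) _))

sign-suc : ∀ k → sign (suc k) ≡ - sign k
sign-suc zero = refl
sign-suc (suc k) = trans (sym (neg-involutive (sign k))) (cong -_ (sym (sign-suc k)))

Odd : ℕ → Set
Odd n = Σ ℕ λ k → n ≡ suc (k ℕ.* 2)

even-or-odd : ∀ n → 2 ∣ n ⊎ Odd n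
even-or-odd zero = inj₁ (divides 0 refl)
even-or-odd (suc n) with even-or-odd n
... | inj₁ (divides q refl) = inj₂ (q , refl)
... | inj₂ (k , refl) = inj₁ (divides (suc k) refl)

sign-odd : ∀ {n} → Odd n → sign n ≡ -1ℤ
sign-odd (k , refl) = trans (sign-suc (k ℕ.* 2)) (cong -_ (sign-even k))
  where
  sign-even : ∀ k → sign (k ℕ.* 2) ≡ 1ℤ
  sign-even zero = refl
  sign-even (suc k) = sign-even k

i≡-i⇒i≡0 : ∀ {i} → i ≡ - i → i ≡ 0ℤ
i≡-i⇒i≡0 {+ zero} _ = refl
i≡-i⇒i≡0 {+ suc m} ()
i≡-i⇒i≡0 { -[1+ m ]} ()

Matrix : Set → ℕ → Set
Matrix A n = Fin n → Fin n → A

_ᵀ : ∀ {A n} → Matrix A n → Matrix A n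
(M ᵀ) i j = M j i

minor : ∀ {A n} → Matrix A (suc n) → Fin (suc n) → Fin (suc n) → Matrix A n
minor M i j r c = M (punchIn i r) (punchIn j c)

detℤ : ∀ {n} → Matrix ℤ n → ℤ
detℤ {zero} M = 1ℤ
detℤ {suc n} M = sum λ j → sign (toℕ j) * (M zero j * detℤ (minor M zero j))

detℤ-cong : ∀ {n} {M N : Matrix ℤ n} → (∀ i j → M i j ≡ N i j) → detℤ M ≡ detℤ N
detℤ-cong {zero} M≡N = refl
detℤ-cong {suc n} M≡N = sum-cong-≗ λ j →
  cong₂ (λ x d → sign (toℕ j) * (x * d))
        (M≡N zero j) (detℤ-cong (λ r c → M≡N (suc r) (punchIn j c)))

detℤ-neg : ∀ {n} (M : Matrix ℤ n) → detℤ (λ i j → - M i j) ≡ sign n * detℤ M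
detℤ-neg {zero} M = refl
detℤ-neg {suc n} M = begin
  sum (λ j → sign (toℕ j) * (- M zero j * detℤ (λ r c → - minor M zero j r c)))
    ≡⟨ sum-cong-≗ (λ j → cong (λ d → sign (toℕ j) * (- M zero j * d)) (detℤ-neg (minor M zero j))) ⟩
  sum (λ j → sign (toℕ j) * (- M zero j * (sign n * detℤ (minor M zero j))))
    ≡⟨ sum-cong-≗ (λ j → pull-sign (sign (toℕ j)) (M zero j) (sign n) (detℤ (minor M zero j))) ⟩
  sum (λ j → - sign n * (sign (toℕ j) * (M zero j * detℤ (minor M zero j))))
    ≡⟨ *-distribˡ-sum (- sign n) (λ j → sign (toℕ j) * (M zero j * detℤ (minor M zero j))) ⟨
  - sign n * detℤ M
    ≡⟨ cong (_* detℤ M) (sign-suc n) ⟨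
  sign (suc n) * detℤ M ∎
  where
  open ≡-Reasoning
  pull-sign : ∀ s m t d → s * (- m * (t * d)) ≡ - t * (s * (m * d))
  pull-sign = solve-∀

TransposeInvariant : ℕ → Set
TransposeInvariant n = (M : Matrix ℤ n) → detℤ (M ᵀ) ≡ detℤ M

detℤ-expand-column : ∀ {n} → TransposeInvariant n → TransposeInvariant (suc n) →
  (M : Matrix ℤ (suc n)) → detℤ M ≡ sum λ i → sign (toℕ i) * (M i zero * detℤ (minor M i zero))
detℤ-expand-column ih₀ ih₁ M = trans (sym (ih₁ M)) (sum-cong-≗ λ i →
  cong (λ d → sign (toℕ i) * (M i zero * d)) (ih₀ (minor M i zero)))

cauchyTerm : ∀ {n} → Matrix ℤ (suc (suc n)) → Fin (suc n) → Fin (suc n) → ℤ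
cauchyTerm M i j = sign (toℕ i) * sign (toℕ j) *
  (M (suc i) zero * M zero (suc j) * detℤ (minor (minor M zero zero) i j))

-- Cauchy's expansion along the first row and column; once smaller determinants are known to be
-- invariant under transposition, its right-hand side visibly is too.
detℤ-cauchy : ∀ {n} → TransposeInvariant n → TransposeInvariant (suc n) →
  (M : Matrix ℤ (suc (suc n))) →
  detℤ M ≡ M zero zero * detℤ (minor M zero zero) - sum λ j → sum λ i → cauchyTerm M i j
detℤ-cauchy ih₀ ih₁ M =
  cong₂ _+_ (*-identityˡ (M zero zero * detℤ (minor M zero zero)))
            (trans (sum-cong-≗ row-term) (sum-neg (λ j → sum λ i → cauchyTerm M i j)))
  where
  open ≡-Reasoning
  regroup : ∀ t m s a d → - t * (m * (s * (a * d))) ≡ - (s * t * (a * m * d))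
  regroup = solve-∀
  row-term : ∀ j → sign (suc (toℕ j)) * (M zero (suc j) * detℤ (minor M zero (suc j)))
                 ≡ - sum (λ i → cauchyTerm M i j)
  row-term j = begin
    sign (suc (toℕ j)) * (M zero (suc j) * detℤ (minor M zero (suc j)))
      ≡⟨ cong₂ (λ s d → s * (M zero (suc j) * d)) (sign-suc (toℕ j))
               (detℤ-expand-column ih₀ ih₁ (minor M zero (suc j))) ⟩
    - sign (toℕ j) * (M zero (suc j) * sum column)
      ≡⟨ cong (- sign (toℕ j) *_) (*-distribˡ-sum (M zero (suc j)) column) ⟩
    - sign (toℕ j) * sum (λ i → M zero (suc j) * column i)
      ≡⟨ *-distribˡ-sum (- sign (toℕ j)) (λ i → M zero (suc j) * column i) ⟩
    sum (λ i → - sign (toℕ j) * (M zero (suc j) * column i))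
      ≡⟨ sum-cong-≗ (λ i →
           regroup (sign (toℕ j)) (M zero (suc j)) (sign (toℕ i)) (M (suc i) zero) (D i)) ⟩
    sum (λ i → - cauchyTerm M i j)
      ≡⟨ sum-neg (λ i → cauchyTerm M i j) ⟩
    - sum (λ i → cauchyTerm M i j) ∎
    where
    D column : Fin (suc _) → ℤ
    D i = detℤ (minor (minor M zero zero) i j)
    column i = sign (toℕ i) * (M (suc i) zero * D i)

transpose-step : ∀ {n} → TransposeInvariant n → TransposeInvariant (suc n) →
  TransposeInvariant (suc (suc n))
transpose-step ih₀ ih₁ M = begin
  detℤ (M ᵀ)
    ≡⟨ detℤ-cauchy ih₀ ih₁ (M ᵀ) ⟩
  M zero zero * detℤ (minor M zero zero ᵀ) - sum (λ j → sum λ i → cauchyTerm (M ᵀ) i j)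
    ≡⟨ cong₂ (λ d s → M zero zero * d - s) (ih₁ (minor M zero zero))
             (sum-cong-≗ λ j → sum-cong-≗ λ i → transposed-term i j) ⟩
  M zero zero * detℤ (minor M zero zero) - sum (λ j → sum λ i → cauchyTerm M j i)
    ≡⟨ cong (λ s → M zero zero * detℤ (minor M zero zero) - s) (∑-comm (cauchyTerm M)) ⟩
  M zero zero * detℤ (minor M zero zero) - sum (λ j → sum λ i → cauchyTerm M i j)
    ≡⟨ detℤ-cauchy ih₀ ih₁ M ⟨
  detℤ M ∎
  where
  open ≡-Reasoning
  swap : ∀ s t a b d → s * t * (a * b * d) ≡ t * s * (b * a * d)
  swap = solve-∀
  transposed-term : ∀ i j → cauchyTerm (M ᵀ) i j ≡ cauchyTerm M j i
  transposed-term i j =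
    trans (cong (λ d → sign (toℕ i) * sign (toℕ j) * (M zero (suc i) * M (suc j) zero * d))
                (ih₀ (minor (minor M zero zero) j i)))
          (swap (sign (toℕ i)) (sign (toℕ j)) (M zero (suc i)) (M (suc j) zero)
                (detℤ (minor (minor M zero zero) j i)))

transpose-invariant : ∀ n → TransposeInvariant n × TransposeInvariant (suc n)
transpose-invariant zero = (λ _ → refl) , (λ _ → refl)
transpose-invariant (suc n) =
  let ih₀ , ih₁ = transpose-invariant n in ih₁ , transpose-step ih₀ ih₁

detℤ-transpose : ∀ {n} (M : Matrix ℤ n) → detℤ (M ᵀ) ≡ detℤ M
detℤ-transpose {n} = proj₁ (transpose-invariant n)

detℤ-skew-odd : ∀ {n} (S : Matrix ℤ n) → (∀ i j → S j i ≡ - S i j) → Odd n → detℤ S ≡ 0ℤ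
detℤ-skew-odd {n} S skew odd = i≡-i⇒i≡0 (begin
  detℤ S                     ≡⟨ detℤ-transpose S ⟨
  detℤ (S ᵀ)                 ≡⟨ detℤ-cong skew ⟩
  detℤ (λ i j → - S i j)     ≡⟨ detℤ-neg S ⟩
  sign n * detℤ S            ≡⟨ cong (_* detℤ S) (sign-odd odd) ⟩
  -1ℤ * detℤ S               ≡⟨ -1*i≡-i (detℤ S) ⟩
  - detℤ S                   ∎)
  where open ≡-Reasoning

identityMatrix : ∀ {n} → Matrix ℤ n
identityMatrix i j = if does (i ≟ j) then 1ℤ else 0ℤ

detℤ-identity : ∀ {n} → detℤ (identityMatrix {n}) ≡ 1ℤ
detℤ-identity {zero} = refl
detℤ-identity {suc n} =
  cong₂ _+_ (cong (λ d → 1ℤ * (1ℤ * d)) (detℤ-identity {n}))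
            (sum-zero {n} {λ j → sign (toℕ (suc j)) * 0ℤ} (λ j → *-zeroʳ (sign (toℕ (suc j)))))

infix 4 _≡_mod_
record _≡_mod_ (x y m : ℤ) : Set where
  constructor by
  field
    quotient : ℤ
    equation : x ≡ y + m * quotient

mod-refl : ∀ {m} x → x ≡ x mod m
mod-refl {m} x = by 0ℤ (sym (trans (cong (_+_ x) (*-zeroʳ m)) (+-identityʳ x)))

mod-+ : ∀ {m x x′ y y′} → x ≡ x′ mod m → y ≡ y′ mod m → x + y ≡ x′ + y′ mod m
mod-+ {m} {x′ = x′} {y′ = y′} (by k refl) (by l refl) = by (k + l) (regroup x′ y′ m k l)
  where
  regroup : ∀ a b m k l → (a + m * k) + (b + m * l) ≡ (a + b) + m * (k + l)
  regroup = solve-∀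

mod-* : ∀ {m x x′ y y′} → x ≡ x′ mod m → y ≡ y′ mod m → x * y ≡ x′ * y′ mod m
mod-* {m} {x′ = x′} {y′ = y′} (by k refl) (by l refl) =
  by (k * y′ + x′ * l + m * k * l) (expand x′ y′ m k l)
  where
  expand : ∀ a b m k l → (a + m * k) * (b + m * l) ≡ a * b + m * (k * b + a * l + m * k * l)
  expand = solve-∀

mod-neg : ∀ {m x y} → x ≡ y mod m → - x ≡ - y mod m
mod-neg {m} {y = y} (by k refl) = by (- k) (negate y m k)
  where
  negate : ∀ a m k → - (a + m * k) ≡ - a + m * - k
  negate = solve-∀

sum-mod : ∀ {m n} {f g : Fin n → ℤ} → (∀ i → f i ≡ g i mod m) → sum f ≡ sum g mod m
sum-mod {n = zero} f≡g = mod-refl 0ℤ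
sum-mod {n = suc n} f≡g = mod-+ (f≡g zero) (sum-mod (λ i → f≡g (suc i)))

detℤ-mod : ∀ {m n} {M N : Matrix ℤ n} → (∀ i j → M i j ≡ N i j mod m) → detℤ M ≡ detℤ N mod m
detℤ-mod {n = zero} M≡N = mod-refl 1ℤ
detℤ-mod {n = suc n} M≡N = sum-mod λ j →
  mod-* (mod-refl (sign (toℕ j)))
        (mod-* (M≡N zero j) (detℤ-mod (λ r c → M≡N (suc r) (punchIn j c))))

1≢0-mod-2 : ¬ (1ℤ ≡ 0ℤ mod + 2)
1≢0-mod-2 (by k 1≡2k) =
  even≢odd ∣ k ∣ 0 (sym (trans (cong ∣_∣ (trans 1≡2k (+-identityˡ (+ 2 * k)))) (abs-* (+ 2) k)))

strictUpper : ∀ {n} → Matrix ℤ n → Matrix ℤ n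
strictUpper M i j = if does (i <? j) then M i j else 0ℤ

symmetric-split : ∀ {n} (M : Matrix ℤ n) → (∀ i j → M j i ≡ M i j) → (∀ i → M i i ≡ 0ℤ) →
  ∀ i j → M i j ≡ strictUpper M i j + strictUpper M j i
symmetric-split M sym-M diag-M i j with <-cmp i j
... | tri< i<j _ j≮i rewrite dec-true (i <? j) i<j | dec-false (j <? i) j≮i =
  sym (+-identityʳ (M i j))
... | tri> i≮j _ j<i rewrite dec-false (i <? j) i≮j | dec-true (j <? i) j<i =
  sym (trans (+-identityˡ (M j i)) (sym-M i j))
... | tri≈ _ refl _ rewrite dec-false (i <? i) (<-irrefl refl) = diag-M i

detℤ-symmetric-odd : ∀ {n} (M : Matrix ℤ n) → (∀ i j → M j i ≡ M i j) → (∀ i → M i i ≡ 0ℤ) →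
  Odd n → detℤ M ≡ 0ℤ mod + 2
detℤ-symmetric-odd M sym-M diag-M odd =
  subst (detℤ M ≡_mod + 2) (detℤ-skew-odd S S-skew odd) (detℤ-mod M≡S)
  where
  S : Matrix ℤ _
  S i j = strictUpper M i j - strictUpper M j i
  S-skew : ∀ i j → S j i ≡ - S i j
  S-skew i j = antisym (strictUpper M i j) (strictUpper M j i)
    where
    antisym : ∀ a b → b - a ≡ - (a - b)
    antisym = solve-∀
  M≡S : ∀ i j → M i j ≡ S i j mod + 2
  M≡S i j = by (strictUpper M j i)
    (trans (symmetric-split M sym-M diag-M i j) (even-gap (strictUpper M i j) (strictUpper M j i)))
    where
    even-gap : ∀ a b → a + b ≡ (a - b) + + 2 * b
    even-gap = solve-∀

coeff-⊕ : ∀ p q k → coeff (p ⊕ q) k ≡ coeff p k + coeff q k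
coeff-⊕ [] q k = sym (+-identityˡ (coeff q k))
coeff-⊕ (x ∷ p) [] k = sym (+-identityʳ (coeff (x ∷ p) k))
coeff-⊕ (x ∷ p) (y ∷ q) zero = refl
coeff-⊕ (x ∷ p) (y ∷ q) (suc k) = coeff-⊕ p q k

coeff-scale : ∀ c p k → coeff (scale c p) k ≡ c * coeff p k
coeff-scale c [] k = sym (*-zeroʳ c)
coeff-scale c (x ∷ p) zero = refl
coeff-scale c (x ∷ p) (suc k) = coeff-scale c p k

coeff-sumFin : ∀ {n} (f : Fin n → Poly) k → coeff (sumFin f) k ≡ sum λ j → coeff (f j) k
coeff-sumFin {zero} f k = refl
coeff-sumFin {suc n} f k =
  trans (coeff-⊕ (f zero) _ k) (cong (_+_ (coeff (f zero) k)) (coeff-sumFin (λ j → f (suc j)) k))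

coeff-∷-⊗ : ∀ x p q k → coeff ((x ∷ p) ⊗ q) k ≡ x * coeff q k + coeff (0ℤ ∷ (p ⊗ q)) k
coeff-∷-⊗ x p q k =
  trans (coeff-⊕ (scale x q) _ k) (cong (_+ coeff (0ℤ ∷ (p ⊗ q)) k) (coeff-scale x q k))

coeff-⊗-zero : ∀ p q → coeff (p ⊗ q) 0 ≡ coeff p 0 * coeff q 0
coeff-⊗-zero [] q = refl
coeff-⊗-zero (x ∷ p) q = trans (coeff-∷-⊗ x p q 0) (+-identityʳ (x * coeff q 0))

Vanishes : Poly → Set
Vanishes p = ∀ k → coeff p k ≡ 0ℤ

0∷-vanishes : ∀ {p} → Vanishes p → Vanishes (0ℤ ∷ p)
0∷-vanishes p≈0 zero = refl
0∷-vanishes p≈0 (suc k) = p≈0 k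

⊗-vanishesˡ : ∀ p q → Vanishes p → Vanishes (p ⊗ q)
⊗-vanishesˡ [] q p≈0 k = refl
⊗-vanishesˡ (x ∷ p) q p≈0 k = begin
  coeff ((x ∷ p) ⊗ q) k                      ≡⟨ coeff-∷-⊗ x p q k ⟩
  x * coeff q k + coeff (0ℤ ∷ (p ⊗ q)) k     ≡⟨ cong₂ (λ y z → y * coeff q k + z) (p≈0 0)
                                                  (0∷-vanishes (⊗-vanishesˡ p q (λ k → p≈0 (suc k))) k) ⟩
  0ℤ                                         ∎
  where open ≡-Reasoning

Degree≤ : ℕ → Poly → Set
Degree≤ d p = ∀ m → d ℕ.< m → coeff p m ≡ 0ℤ

coeff-⊗-linear : ∀ p q k → Degree≤ 1 p →
  coeff (p ⊗ q) (suc k) ≡ coeff p 0 * coeff q (suc k) + coeff p 1 * coeff q k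
coeff-⊗-linear [] q k _ = refl
coeff-⊗-linear (x ∷ []) q k _ = coeff-∷-⊗ x [] q (suc k)
coeff-⊗-linear (x ∷ y ∷ p) q k deg = begin
  coeff ((x ∷ y ∷ p) ⊗ q) (suc k)
    ≡⟨ coeff-∷-⊗ x (y ∷ p) q (suc k) ⟩
  x * coeff q (suc k) + coeff ((y ∷ p) ⊗ q) k
    ≡⟨ cong (_+_ (x * coeff q (suc k))) (coeff-∷-⊗ y p q k) ⟩
  x * coeff q (suc k) + (y * coeff q k + coeff (0ℤ ∷ (p ⊗ q)) k)
    ≡⟨ cong (λ z → x * coeff q (suc k) + (y * coeff q k + z)) (0∷-vanishes (⊗-vanishesˡ p q p≈0) k) ⟩
  x * coeff q (suc k) + (y * coeff q k + 0ℤ)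
    ≡⟨ cong (_+_ (x * coeff q (suc k))) (+-identityʳ (y * coeff q k)) ⟩
  x * coeff q (suc k) + y * coeff q k ∎
  where
  open ≡-Reasoning
  p≈0 : Vanishes p
  p≈0 m = deg (suc (suc m)) (s≤s (s≤s z≤n))

cofactorTerm : ∀ {n} → Matrix Poly (suc n) → Fin (suc n) → Poly
cofactorTerm M j = scale (sign (toℕ j)) (M zero j ⊗ det (minor M zero j))

coeff-det-zero : ∀ {n} (M : Matrix Poly n) → coeff (det M) 0 ≡ detℤ λ i j → coeff (M i j) 0
coeff-det-zero {zero} M = refl
coeff-det-zero {suc n} M = trans (coeff-sumFin (cofactorTerm M) 0) (sum-cong-≗ λ j →
  trans (coeff-scale (sign (toℕ j)) (M zero j ⊗ det (minor M zero j)) 0)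
        (cong (sign (toℕ j) *_) (trans (coeff-⊗-zero (M zero j) (det (minor M zero j)))
                                       (cong (coeff (M zero j) 0 *_) (coeff-det-zero (minor M zero j))))))

coeff-det-suc : ∀ {n} (M : Matrix Poly (suc n)) → (∀ j → Degree≤ 1 (M zero j)) → ∀ k →
  coeff (det M) (suc k) ≡ sum λ j → sign (toℕ j) * (coeff (M zero j) 0 * coeff (det (minor M zero j)) (suc k)
                                                   + coeff (M zero j) 1 * coeff (det (minor M zero j)) k)
coeff-det-suc M deg k = trans (coeff-sumFin (cofactorTerm M) (suc k)) (sum-cong-≗ λ j →
  trans (coeff-scale (sign (toℕ j)) (M zero j ⊗ det (minor M zero j)) (suc k))
        (cong (sign (toℕ j) *_) (coeff-⊗-linear (M zero j) (det (minor M zero j)) k (deg j))))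

det-degree : ∀ {n} (M : Matrix Poly n) → (∀ i j → Degree≤ 1 (M i j)) → Degree≤ n (det M)
det-degree {zero} M deg (suc m) _ = refl
det-degree {suc n} M deg (suc m) (s≤s n<m) =
  trans (coeff-det-suc M (deg zero) m) (sum-zero λ j →
    trans (cong₂ (λ u v → sign (toℕ j) * (coeff (M zero j) 0 * u + coeff (M zero j) 1 * v))
                 (minor-degree j (suc m) (m<n⇒m<1+n n<m)) (minor-degree j m n<m))
          (annihilate (sign (toℕ j)) (coeff (M zero j) 0) (coeff (M zero j) 1)))
  where
  minor-degree : ∀ j → Degree≤ n (det (minor M zero j))
  minor-degree j = det-degree (minor M zero j) (λ r c → deg (suc r) (punchIn j c))
  annihilate : ∀ s a b → s * (a * 0ℤ + b * 0ℤ) ≡ 0ℤ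
  annihilate = solve-∀

coeff-det-top : ∀ {n} (M : Matrix Poly n) → (∀ i j → Degree≤ 1 (M i j)) →
  coeff (det M) n ≡ detℤ λ i j → coeff (M i j) 1
coeff-det-top {zero} M deg = refl
coeff-det-top {suc n} M deg =
  trans (coeff-det-suc M (deg zero) n) (sum-cong-≗ λ j →
    trans (cong₂ (λ u v → sign (toℕ j) * (coeff (M zero j) 0 * u + coeff (M zero j) 1 * v))
                 (det-degree (minor M zero j) (minor-deg j) (suc n) (n<1+n n))
                 (coeff-det-top (minor M zero j) (minor-deg j)))
          (drop-zero (sign (toℕ j)) (coeff (M zero j) 0) (coeff (M zero j) 1) _))
  where
  minor-deg : ∀ j r c → Degree≤ 1 (minor M zero j r c)
  minor-deg j r c = deg (suc r) (punchIn j c)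
  drop-zero : ∀ s a b d → s * (a * 0ℤ + b * d) ≡ s * (b * d)
  drop-zero = solve-∀

linear : Bool → ℤ → Poly
linear b c = (if b then X else []) ⊕ const c

linear-degree≤1 : ∀ b c → Degree≤ 1 (linear b c)
linear-degree≤1 b c (suc zero) (s≤s ())
linear-degree≤1 true c (suc (suc m)) _ = refl
linear-degree≤1 false c (suc (suc m)) _ = refl

coeff-linear-0 : ∀ b c → coeff (linear b c) 0 ≡ c
coeff-linear-0 true c = +-identityˡ c
coeff-linear-0 false c = refl

coeff-linear-1 : ∀ b c → coeff (linear b c) 1 ≡ (if b then 1ℤ else 0ℤ)
coeff-linear-1 true c = refl
coeff-linear-1 false c = refl

module _ {n} (G : Graph n) where

  charMatrix-degree≤1 : ∀ i j → Degree≤ 1 (charMatrix G i j)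
  charMatrix-degree≤1 i j = linear-degree≤1 (does (i ≟ j)) (- adjMatrix G i j)

  charMatrix-coeff-0 : ∀ i j → coeff (charMatrix G i j) 0 ≡ - adjMatrix G i j
  charMatrix-coeff-0 i j = coeff-linear-0 (does (i ≟ j)) (- adjMatrix G i j)

  charMatrix-coeff-1 : ∀ i j → coeff (charMatrix G i j) 1 ≡ identityMatrix i j
  charMatrix-coeff-1 i j = coeff-linear-1 (does (i ≟ j)) (- adjMatrix G i j)

  charPoly-monic : coeff (charPoly G) n ≡ 1ℤ
  charPoly-monic = begin
    coeff (charPoly G) n                             ≡⟨ coeff-det-top (charMatrix G) charMatrix-degree≤1 ⟩
    detℤ (λ i j → coeff (charMatrix G i j) 1)         ≡⟨ detℤ-cong charMatrix-coeff-1 ⟩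
    detℤ (identityMatrix {n})                        ≡⟨ detℤ-identity {n} ⟩
    1ℤ                                               ∎
    where open ≡-Reasoning

  charPoly-constant-even : Odd n → coeff (charPoly G) 0 ≡ 0ℤ mod + 2
  charPoly-constant-even odd =
    subst (_≡ 0ℤ mod + 2)
          (sym (trans (coeff-det-zero (charMatrix G)) (detℤ-cong charMatrix-coeff-0)))
          (detℤ-symmetric-odd (λ i j → - adjMatrix G i j) adjacency-sym adjacency-diag odd)
    where
    adjacency-sym : ∀ i j → - adjMatrix G j i ≡ - adjMatrix G i j
    adjacency-sym i j = cong (λ b → - (if b then 1ℤ else 0ℤ)) (Graph.sym G j i)
    adjacency-diag : ∀ i → - adjMatrix G i i ≡ 0ℤ
    adjacency-diag i = cong (λ b → - (if b then 1ℤ else 0ℤ)) (Graph.irrefl G i)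

corollary1 : (n : ℕ) (G : Graph n) → Palindromic G ⊎ Antipalindromic G → 2 ∣ n
corollary1 n G ends-match with even-or-odd n
... | inj₁ 2∣n = 2∣n
... | inj₂ odd = ⊥-elim (1≢0-mod-2 (one-even ends-match))
  where
  last-even : a G n ≡ 0ℤ mod + 2
  last-even =
    subst (λ k → coeff (charPoly G) k ≡ 0ℤ mod + 2) (sym (n∸n≡0 n)) (charPoly-constant-even G odd)
  one-even : Palindromic G ⊎ Antipalindromic G → 1ℤ ≡ 0ℤ mod + 2
  one-even (inj₁ pal) =
    subst (_≡ 0ℤ mod + 2) (trans (sym (pal zero)) (charPoly-monic G)) last-even
  one-even (inj₂ anti) =
    subst (_≡ 0ℤ mod + 2) (trans (sym (anti zero)) (charPoly-monic G)) (mod-neg last-even)
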